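{- Let $\mathcal{M}$ be a model of $\mathsf{HA}$. There is a unary formula $\varphi(x)$ with $\forall e:\mathcal{M}.\ (\mathsf{std}(e)\leftrightarrow \mathcal{M}\vDash\varphi(e))$ if and only if $\mathcal{M}\cong\mathbb{N}$.
   Context: Meta-theory: constructive type theory (Calculus of Inductive Constructions), no classical axioms assumed. Arithmetic signature $0,S,+,\times,=$; $\mathsf{HA}$ is Heyting arithmetic (axioms for successor disjointness/injectivity, recursion equations for $+$ and $\times$, equality axioms, and the induction scheme for all formulas, with intuitionistic deduction). A model $\mathcal{M}$ of $\mathsf{HA}$ is a type with interpretations of $0,S,+,\times$, with $=$ interpreted as actual equality, satisfying the $\mathsf{HA}$ axioms under Tarski semantics (connectives/quantifiers interpreted type-theoretically). $\mathcal{M}\vDash\varphi(e)$ means $\varphi$ holds in $\mathcal{M}$ under every environment assigning $e$ to the free variable $x$. $\overline{n}$ denotes $(S^{\mathcal{M}})^n(0^{\mathcal{M}})$; $\mathsf{std}(e):=\exists n:\mathbb{N}.\ \overline{n}=e$. $\mathcal{M}\cong\mathbb{N}$ means there is a bijective homomorphism $\mathbb{N}\to\mathcal{M}$. -}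

module Defs where

open import Data.Nat using (ℕ; zero; suc; _<_)
open import Data.Empty using (⊥)
open import Data.Product using (Σ; _×_)
open import Data.Sum using (_⊎_)
open import Relation.Binary.PropositionalEquality using (_≡_)
open import Function.Definitions using (Bijective)

infixl 6 _⊕_
infixl 7 _⊗_

data Term : Set where
  var  : ℕ → Term
  zer  : Term
  succ : Term → Term
  _⊕_  : Term → Term → Term
  _⊗_  : Term → Term → Term

infix  4 _≐_
infixr 3 _⇒_
infixr 4 _∨̇_
infixr 5 _∧̇_

data Formula : Set where
  ⊥̇    : Formula
  _≐_  : Term → Term → Formula
  _∧̇_  : Formula → Formula → Formula
  _∨̇_  : Formula → Formula → Formula
  _⇒_  : Formula → Formula → Formula
  ∀̇    : Formula → Formula
  ∃̇    : Formula → Formula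

¬̇ : Formula → Formula
¬̇ φ = φ ⇒ ⊥̇

renT : (ℕ → ℕ) → Term → Term
renT r (var k)  = var (r k)
renT r zer      = zer
renT r (succ t) = succ (renT r t)
renT r (t ⊕ u)  = renT r t ⊕ renT r u
renT r (t ⊗ u)  = renT r t ⊗ renT r u

substT : (ℕ → Term) → Term → Term
substT σ (var k)  = σ k
substT σ zer      = zer
substT σ (succ t) = succ (substT σ t)
substT σ (t ⊕ u)  = substT σ t ⊕ substT σ u
substT σ (t ⊗ u)  = substT σ t ⊗ substT σ u

up : (ℕ → Term) → ℕ → Term
up σ zero    = var zero
up σ (suc k) = renT suc (σ k)

substF : (ℕ → Term) → Formula → Formula
substF σ ⊥̇       = ⊥̇
substF σ (t ≐ u) = substT σ t ≐ substT σ u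
substF σ (φ ∧̇ ψ) = substF σ φ ∧̇ substF σ ψ
substF σ (φ ∨̇ ψ) = substF σ φ ∨̇ substF σ ψ
substF σ (φ ⇒ ψ) = substF σ φ ⇒ substF σ ψ
substF σ (∀̇ φ)   = ∀̇ (substF (up σ) φ)
substF σ (∃̇ φ)   = ∃̇ (substF (up σ) φ)

-- φ[0/x₀] (the other variables shift down)
σ-zero : ℕ → Term
σ-zero zero    = zer
σ-zero (suc k) = var k

σ-succ : ℕ → Term
σ-succ zero    = succ (var zero)
σ-succ (suc k) = var (suc k)

data TermBound (n : ℕ) : Term → Set where
  var  : ∀ {k} → k < n → TermBound n (var k)
  zer  : TermBound n zer
  succ : ∀ {t} → TermBound n t → TermBound n (succ t)
  plus : ∀ {t u} → TermBound n t → TermBound n u → TermBound n (t ⊕ u)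
  mult : ∀ {t u} → TermBound n t → TermBound n u → TermBound n (t ⊗ u)

data Bound : ℕ → Formula → Set where
  fal : ∀ {n} → Bound n ⊥̇
  eq  : ∀ {n t u} → TermBound n t → TermBound n u → Bound n (t ≐ u)
  and : ∀ {n φ ψ} → Bound n φ → Bound n ψ → Bound n (φ ∧̇ ψ)
  or  : ∀ {n φ ψ} → Bound n φ → Bound n ψ → Bound n (φ ∨̇ ψ)
  imp : ∀ {n φ ψ} → Bound n φ → Bound n ψ → Bound n (φ ⇒ ψ)
  all : ∀ {n φ} → Bound (suc n) φ → Bound n (∀̇ φ)
  ex  : ∀ {n φ} → Bound (suc n) φ → Bound n (∃̇ φ)

Unary : Formula → Set
Unary φ = Bound 1 φ

-- Axioms of HA (equality axioms are omitted: = is interpreted as actual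
-- equality, so they hold in every structure).

data HAAxiom : Formula → Set where
  ax-S≢0    : HAAxiom (∀̇ (¬̇ (succ (var 0) ≐ zer)))
  ax-S-inj  : HAAxiom (∀̇ (∀̇ (succ (var 1) ≐ succ (var 0) ⇒ var 1 ≐ var 0)))
  ax-+-0    : HAAxiom (∀̇ (var 0 ⊕ zer ≐ var 0))
  ax-+-S    : HAAxiom (∀̇ (∀̇ (var 1 ⊕ succ (var 0) ≐ succ (var 1 ⊕ var 0))))
  ax-*-0    : HAAxiom (∀̇ (var 0 ⊗ zer ≐ zer))
  ax-*-S    : HAAxiom (∀̇ (∀̇ (var 1 ⊗ succ (var 0) ≐ var 1 ⊗ var 0 ⊕ var 1)))
  ax-ind    : ∀ φ → HAAxiom (substF σ-zero φ ∧̇ ∀̇ (φ ⇒ substF σ-succ φ) ⇒ ∀̇ φ)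

record Structure : Set₁ where
  field
    D    : Set
    z    : D
    s    : D → D
    add  : D → D → D
    mul  : D → D → D

module _ (𝔐 : Structure) where
  open Structure 𝔐

  Env : Set
  Env = ℕ → D

  _∷ₑ_ : D → Env → Env
  (d ∷ₑ ρ) zero    = d
  (d ∷ₑ ρ) (suc k) = ρ k

  evalT : Env → Term → D
  evalT ρ (var k)  = ρ k
  evalT ρ zer      = z
  evalT ρ (succ t) = s (evalT ρ t)
  evalT ρ (t ⊕ u)  = add (evalT ρ t) (evalT ρ u)
  evalT ρ (t ⊗ u)  = mul (evalT ρ t) (evalT ρ u)

  sat : Env → Formula → Set
  sat ρ ⊥̇       = ⊥
  sat ρ (t ≐ u) = evalT ρ t ≡ evalT ρ u
  sat ρ (φ ∧̇ ψ) = sat ρ φ × sat ρ ψ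
  sat ρ (φ ∨̇ ψ) = sat ρ φ ⊎ sat ρ ψ
  sat ρ (φ ⇒ ψ) = sat ρ φ → sat ρ ψ
  sat ρ (∀̇ φ)   = (d : D) → sat (d ∷ₑ ρ) φ
  sat ρ (∃̇ φ)   = Σ D λ d → sat (d ∷ₑ ρ) φ

record HAModel : Set₁ where
  field
    structure : Structure
  open Structure structure public
  field
    axioms : ∀ φ → HAAxiom φ → (ρ : Env structure) → sat structure ρ φ

module _ (𝓜 : HAModel) where
  open HAModel 𝓜

  _⊨_[_] : Formula → D → Set
  _⊨_[_] φ e = (ρ : Env structure) → ρ 0 ≡ e → sat structure ρ φ

  num : ℕ → D
  num zero    = z
  num (suc n) = s (num n)

  std : D → Set
  std e = Σ ℕ λ n → num n ≡ e

  record IsHom (h : ℕ → D) : Set where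
    field
      hom-0 : h 0 ≡ z
      hom-S : ∀ n → h (suc n) ≡ s (h n)
      hom-+ : ∀ m n → h (m Data.Nat.+ n) ≡ add (h m) (h n)
      hom-* : ∀ m n → h (m Data.Nat.* n) ≡ mul (h m) (h n)

  IsoToℕ : Set
  IsoToℕ = Σ (ℕ → D) λ h → IsHom h × Bijective _≡_ _≡_ h

module Submission where

open import Defs
open import Data.Nat using (ℕ; zero; suc; _+_; _*_; _<_; s≤s; z≤n)
open import Data.Nat.Properties using (+-identityʳ; +-suc; *-zeroʳ; *-suc; +-comm)
open import Data.Product using (Σ; _×_; _,_)
open import Data.Product.Function.Dependent.Propositional using (Σ-⇔)
open import Data.Product.Function.NonDependent.Propositional using (_×-⇔_)
open import Data.Sum.Function.Propositional using (_⊎-⇔_)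
open import Data.Empty using (⊥-elim)
open import Function using (_∘_)
open import Function.Bundles using (_⇔_; mk⇔; module Equivalence)
open import Function.Consequences.Propositional using (strictlySurjective⇒surjective)
open import Function.Construct.Identity using (⇔-id; ↠-id)
open import Function.Related.TypeIsomorphisms using (→-cong-⇔)
open import Relation.Binary.PropositionalEquality
open ≡-Reasoning

open Equivalence using (to; from)

-- If the standard elements were carved out by a formula φ(x), then, since
-- they contain 0 and are closed under S, the induction axiom for φ would make
-- every element standard; the numerals S^n(0) then form an isomorphism ℕ ≅ 𝓜,
-- because the recursion and successor axioms of HA make n ↦ S^n(0) an
-- injective homomorphism. Conversely, in a model isomorphic to ℕ every element
-- is standard, and x = x defines them.

Π-⇔ : {A : Set} {P Q : A → Set} → (∀ x → P x ⇔ Q x) → ((x : A) → P x) ⇔ ((x : A) → Q x)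
Π-⇔ P⇔Q = mk⇔ (λ f x → to (P⇔Q x) (f x)) (λ g x → from (P⇔Q x) (g x))

≡-cong-⇔ : {A : Set} {a a′ b b′ : A} → a ≡ a′ → b ≡ b′ → (a ≡ b) ⇔ (a′ ≡ b′)
≡-cong-⇔ a≡a′ b≡b′ = mk⇔ (subst₂ _≡_ a≡a′ b≡b′) (subst₂ _≡_ (sym a≡a′) (sym b≡b′))

module _ (𝔐 : Structure) where
  open Structure 𝔐

  private
    _∷_ : D → Env 𝔐 → Env 𝔐
    _∷_ = _∷ₑ_ 𝔐

  AgreeBelow : ℕ → Env 𝔐 → Env 𝔐 → Set
  AgreeBelow n ρ ρ′ = ∀ {k} → k < n → ρ k ≡ ρ′ k

  agreeBelow-∷ : ∀ {n ρ ρ′} d → AgreeBelow n ρ ρ′ → AgreeBelow (suc n) (d ∷ ρ) (d ∷ ρ′)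
  agreeBelow-∷ d agree {zero}  _         = refl
  agreeBelow-∷ d agree {suc k} (s≤s k<n) = agree k<n

  evalT-cong : ∀ {n t ρ ρ′} → TermBound n t → AgreeBelow n ρ ρ′ → evalT 𝔐 ρ t ≡ evalT 𝔐 ρ′ t
  evalT-cong (var k<n)  agree = agree k<n
  evalT-cong zer        agree = refl
  evalT-cong (succ t)   agree = cong s (evalT-cong t agree)
  evalT-cong (plus t u) agree = cong₂ add (evalT-cong t agree) (evalT-cong u agree)
  evalT-cong (mult t u) agree = cong₂ mul (evalT-cong t agree) (evalT-cong u agree)

  sat-cong : ∀ {n φ ρ ρ′} → Bound n φ → AgreeBelow n ρ ρ′ → sat 𝔐 ρ φ ⇔ sat 𝔐 ρ′ φ
  sat-cong fal       agree = ⇔-id _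
  sat-cong (eq t u)  agree = ≡-cong-⇔ (evalT-cong t agree) (evalT-cong u agree)
  sat-cong (and φ ψ) agree = sat-cong φ agree ×-⇔ sat-cong ψ agree
  sat-cong (or φ ψ)  agree = sat-cong φ agree ⊎-⇔ sat-cong ψ agree
  sat-cong (imp φ ψ) agree = →-cong-⇔ (sat-cong φ agree) (sat-cong ψ agree)
  sat-cong (all φ)   agree = Π-⇔ λ d → sat-cong φ (agreeBelow-∷ d agree)
  sat-cong (ex φ)    agree = Σ-⇔ (↠-id _) λ {d} → sat-cong φ (agreeBelow-∷ d agree)

  evalT-renT : ∀ r ρ t → evalT 𝔐 ρ (renT r t) ≡ evalT 𝔐 (ρ ∘ r) t
  evalT-renT r ρ (var k)  = refl
  evalT-renT r ρ zer      = refl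
  evalT-renT r ρ (succ t) = cong s (evalT-renT r ρ t)
  evalT-renT r ρ (t ⊕ u)  = cong₂ add (evalT-renT r ρ t) (evalT-renT r ρ u)
  evalT-renT r ρ (t ⊗ u)  = cong₂ mul (evalT-renT r ρ t) (evalT-renT r ρ u)

  evalT-substT : ∀ {σ ρ τ} → τ ≗ evalT 𝔐 ρ ∘ σ → ∀ t → evalT 𝔐 ρ (substT σ t) ≡ evalT 𝔐 τ t
  evalT-substT τ≗ (var k)  = sym (τ≗ k)
  evalT-substT τ≗ zer      = refl
  evalT-substT τ≗ (succ t) = cong s (evalT-substT τ≗ t)
  evalT-substT τ≗ (t ⊕ u)  = cong₂ add (evalT-substT τ≗ t) (evalT-substT τ≗ u)
  evalT-substT τ≗ (t ⊗ u)  = cong₂ mul (evalT-substT τ≗ t) (evalT-substT τ≗ u)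

  up-∷ : ∀ {σ ρ τ} d → τ ≗ evalT 𝔐 ρ ∘ σ → d ∷ τ ≗ evalT 𝔐 (d ∷ ρ) ∘ up σ
  up-∷         d τ≗ zero    = refl
  up-∷ {σ} {ρ} d τ≗ (suc k) = trans (τ≗ k) (sym (evalT-renT suc (d ∷ ρ) (σ k)))

  sat-substF : ∀ {σ ρ τ} → τ ≗ evalT 𝔐 ρ ∘ σ → ∀ φ → sat 𝔐 ρ (substF σ φ) ⇔ sat 𝔐 τ φ
  sat-substF τ≗ ⊥̇       = ⇔-id _
  sat-substF τ≗ (t ≐ u) = ≡-cong-⇔ (evalT-substT τ≗ t) (evalT-substT τ≗ u)
  sat-substF τ≗ (φ ∧̇ ψ) = sat-substF τ≗ φ ×-⇔ sat-substF τ≗ ψ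
  sat-substF τ≗ (φ ∨̇ ψ) = sat-substF τ≗ φ ⊎-⇔ sat-substF τ≗ ψ
  sat-substF τ≗ (φ ⇒ ψ) = →-cong-⇔ (sat-substF τ≗ φ) (sat-substF τ≗ ψ)
  sat-substF τ≗ (∀̇ φ)   = Π-⇔ λ d → sat-substF (up-∷ d τ≗) φ
  sat-substF τ≗ (∃̇ φ)   = Σ-⇔ (↠-id _) λ {d} → sat-substF (up-∷ d τ≗) φ

module _ (𝓜 : HAModel) where
  open HAModel 𝓜

  private
    _∷_ : D → Env structure → Env structure
    _∷_ = _∷ₑ_ structure

    ρ₀ : Env structure
    ρ₀ _ = z

    axiom : ∀ {φ} → HAAxiom φ → sat structure ρ₀ φ
    axiom ax = axioms _ ax ρ₀

  num-+ : ∀ m n → num 𝓜 (m + n) ≡ add (num 𝓜 m) (num 𝓜 n)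
  num-+ m zero = begin
    num 𝓜 (m + 0)         ≡⟨ cong (num 𝓜) (+-identityʳ m) ⟩
    num 𝓜 m               ≡⟨ axiom ax-+-0 (num 𝓜 m) ⟨
    add (num 𝓜 m) z       ∎
  num-+ m (suc n) = begin
    num 𝓜 (m + suc n)                ≡⟨ cong (num 𝓜) (+-suc m n) ⟩
    s (num 𝓜 (m + n))                ≡⟨ cong s (num-+ m n) ⟩
    s (add (num 𝓜 m) (num 𝓜 n))      ≡⟨ axiom ax-+-S (num 𝓜 m) (num 𝓜 n) ⟨
    add (num 𝓜 m) (num 𝓜 (suc n))    ∎

  num-* : ∀ m n → num 𝓜 (m * n) ≡ mul (num 𝓜 m) (num 𝓜 n)
  num-* m zero = begin
    num 𝓜 (m * 0)         ≡⟨ cong (num 𝓜) (*-zeroʳ m) ⟩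
    z                     ≡⟨ axiom ax-*-0 (num 𝓜 m) ⟨
    mul (num 𝓜 m) z       ∎
  num-* m (suc n) = begin
    num 𝓜 (m * suc n)                       ≡⟨ cong (num 𝓜) (trans (*-suc m n) (+-comm m (m * n))) ⟩
    num 𝓜 (m * n + m)                       ≡⟨ num-+ (m * n) m ⟩
    add (num 𝓜 (m * n)) (num 𝓜 m)           ≡⟨ cong (λ x → add x (num 𝓜 m)) (num-* m n) ⟩
    add (mul (num 𝓜 m) (num 𝓜 n)) (num 𝓜 m) ≡⟨ axiom ax-*-S (num 𝓜 m) (num 𝓜 n) ⟨
    mul (num 𝓜 m) (num 𝓜 (suc n))           ∎

  num-injective : ∀ {m n} → num 𝓜 m ≡ num 𝓜 n → m ≡ n
  num-injective {zero}  {zero}  _  = refl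
  num-injective {zero}  {suc n} 0≡ = ⊥-elim (axiom ax-S≢0 (num 𝓜 n) (sym 0≡))
  num-injective {suc m} {zero}  ≡0 = ⊥-elim (axiom ax-S≢0 (num 𝓜 m) ≡0)
  num-injective {suc m} {suc n} ≡S = cong suc (num-injective (axiom ax-S-inj (num 𝓜 m) (num 𝓜 n) ≡S))

  num-isHom : IsHom 𝓜 (num 𝓜)
  num-isHom = record { hom-0 = refl ; hom-S = λ _ → refl ; hom-+ = num-+ ; hom-* = num-* }

  isHom⇒≗num : ∀ {h} → IsHom 𝓜 h → h ≗ num 𝓜
  isHom⇒≗num hom zero    = IsHom.hom-0 hom
  isHom⇒≗num hom (suc n) = trans (IsHom.hom-S hom n) (cong s (isHom⇒≗num hom n))

  sat-induction : ∀ φ ρ → sat structure (z ∷ ρ) φ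
                → (∀ d → sat structure (d ∷ ρ) φ → sat structure (s d ∷ ρ) φ)
                → ∀ d → sat structure (d ∷ ρ) φ
  sat-induction φ ρ base step =
    axioms _ (ax-ind φ) ρ
      ( from (sat-substF structure zero≗ φ) base
      , λ d → from (sat-substF structure (succ≗ d) φ) ∘ step d)
    where
    zero≗ : z ∷ ρ ≗ evalT structure ρ ∘ σ-zero
    zero≗ zero    = refl
    zero≗ (suc k) = refl
    succ≗ : ∀ d → s d ∷ ρ ≗ evalT structure (d ∷ ρ) ∘ σ-succ
    succ≗ d zero    = refl
    succ≗ d (suc k) = refl

  unary-⊨ : ∀ {φ} → Unary φ → ∀ ρ → sat structure ρ φ → 𝓜 ⊨ φ [ ρ 0 ]
  unary-⊨ unary ρ ρ⊨φ ρ′ ρ′0≡ρ0 = to (sat-cong structure unary agree) ρ⊨φ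
    where
    agree : AgreeBelow structure 1 ρ ρ′
    agree {zero}  _          = sym ρ′0≡ρ0
    agree {suc k} (s≤s ())

  ⊨-induction : ∀ {φ} → Unary φ → 𝓜 ⊨ φ [ z ]
              → (∀ d → 𝓜 ⊨ φ [ d ] → 𝓜 ⊨ φ [ s d ])
              → ∀ d → 𝓜 ⊨ φ [ d ]
  ⊨-induction {φ} unary base step d =
    unary-⊨ unary (d ∷ ρ₀) (sat-induction φ ρ₀ (base _ refl) step′ d)
    where
    step′ : ∀ d → sat structure (d ∷ ρ₀) φ → sat structure (s d ∷ ρ₀) φ
    step′ d ⊨d = step d (unary-⊨ unary (d ∷ ρ₀) ⊨d) _ refl

  AllStandard : Set
  AllStandard = ∀ e → std 𝓜 e

  definesStd⇒allStandard : ∀ {φ} → Unary φ → (∀ e → std 𝓜 e ⇔ 𝓜 ⊨ φ [ e ]) → AllStandard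
  definesStd⇒allStandard {φ} unary defines e =
    from (defines e) (⊨-induction unary (to (defines z) (0 , refl)) std-suc e)
    where
    std-suc : ∀ d → 𝓜 ⊨ φ [ d ] → 𝓜 ⊨ φ [ s d ]
    std-suc d ⊨d with from (defines d) ⊨d
    ... | n , n̄≡d = to (defines (s d)) (suc n , cong s n̄≡d)

  allStandard⇒isoToℕ : AllStandard → IsoToℕ 𝓜
  allStandard⇒isoToℕ allStd =
    num 𝓜 , num-isHom , num-injective , strictlySurjective⇒surjective allStd

  isoToℕ⇒allStandard : IsoToℕ 𝓜 → AllStandard
  isoToℕ⇒allStandard (h , hom , _ , surjective) e with surjective e
  ... | n , hn≡e = n , trans (sym (isHom⇒≗num hom n)) (hn≡e refl)

lemma4p5 : (𝓜 : HAModel)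
    → (Σ Formula λ φ → Unary φ × ((e : HAModel.D 𝓜) → std 𝓜 e ⇔ (𝓜 ⊨ φ [ e ])))
    ⇔ IsoToℕ 𝓜
lemma4p5 𝓜 = mk⇔
  (λ (φ , unary , defines) → allStandard⇒isoToℕ 𝓜 (definesStd⇒allStandard 𝓜 unary defines))
  (λ iso → (var 0 ≐ var 0) , eq (var (s≤s z≤n)) (var (s≤s z≤n))
         , λ e → mk⇔ (λ _ _ _ → refl) (λ _ → isoToℕ⇒allStandard 𝓜 iso e))
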